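{- Every three-player Nim position (a finite disjunctive sum of Nim heaps) is equivalent to exactly one of the following pairwise inequivalent positions: $1^a$ ($a\ge 0$, where $1^0=0$), $1^a+2$ ($a\ge 0$), the single heap $3$, and $2+2$. Their types are: $1^a$ is of type $\mathcal P,\mathcal N,\mathcal O$ according as $a\equiv 0,1,2 \pmod 3$; $1^a+2$ is of type $\mathcal N,\mathcal Q,\mathcal N$ according as $a\equiv 0,1,2\pmod 3$; $3$ is of type $\mathcal N$; $2+2$ is of type $\mathcal Q$. Moreover, the reduced form of a Nim position is obtained as follows: replacing every heap of size greater than $3$ by a heap of size $3$ yields an equivalent position $1^a+2^b+3^c$; if $b+c\ge 2$ it is equivalent to $2+2$; otherwise it is $1^a$, $1^a+2$ or $1^a+3$, and $1^a+3$ is equivalent to $1^a+2$ when $a\ge 1$.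
   Context: A (finite impartial) game is defined recursively as a finite set of games, its options; $0$ is the game with no options. Three players alternate moves cyclically; a move replaces the current game by one of its options, and the player who makes the last move wins. The disjunctive sum $G+H$ is the game whose options are all $G'+H$ ($G'$ an option of $G$) and all $G+H'$ ($H'$ an option of $H$). Types are defined recursively: $G$ is of type $\mathcal N$ iff it has some option of type $\mathcal P$; of type $\mathcal O$ iff it has at least one option and all its options are of type $\mathcal N$; of type $\mathcal P$ iff all its options are of type $\mathcal O$ (so $0$ is of type $\mathcal P$); of type $\mathcal Q$ otherwise. Two games $G,H$ are equivalent if for every game $X$, $G+X$ and $H+X$ have the same type. The Nim heap of size $n$, denoted $n$, is the game whose options are the heaps $0,1,\dots,n-1$. $1^a$ denotes the sum of $a$ heaps of size $1$, and similarly $2^b$, $3^c$. -}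

module Defs where

open import Data.Nat using (ℕ; zero; suc)
open import Data.Bool using (Bool; true; false; if_then_else_)
open import Data.List using (List; []; _∷_; _++_; null; replicate; foldr)
open import Data.Bool.ListAction using (any; all)
open import Relation.Binary.PropositionalEquality using (_≡_)

-- A finite impartial game: a finite collection of options (games).
-- (A list is used for the collection; order/multiplicity of options is
-- irrelevant to types and sums, hence to everything stated.)
data Game : Set where
  mk : List Game → Game

zeroG : Game
zeroG = mk []

mutual
  _⊕_ : Game → Game → Game
  mk gs ⊕ mk hs = mk (leftOpts gs (mk hs) ++ rightOpts (mk gs) hs)

  leftOpts : List Game → Game → List Game
  leftOpts [] h = []
  leftOpts (g ∷ gs) h = (g ⊕ h) ∷ leftOpts gs h

  rightOpts : Game → List Game → List Game
  rightOpts g [] = []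
  rightOpts g (h ∷ hs) = (g ⊕ h) ∷ rightOpts g hs

infixr 6 _⊕_

data GType : Set where
  𝒩 𝒪 𝒫 𝒬 : GType

isN isO isP : GType → Bool
isN 𝒩 = true
isN _ = false
isO 𝒪 = true
isO _ = false
isP 𝒫 = true
isP _ = false

classify : List GType → GType
classify ts =
  if any isP ts then 𝒩
  else if (if null ts then false else all isN ts) then 𝒪
  else if all isO ts then 𝒫
  else 𝒬

mutual
  type : Game → GType
  type (mk gs) = classify (types gs)

  types : List Game → List GType
  types [] = []
  types (g ∷ gs) = type g ∷ types gs

_≈_ : Game → Game → Set
G ≈ H = (X : Game) → type (G ⊕ X) ≡ type (H ⊕ X)

infix 4 _≈_

mutual
  heap : ℕ → Game
  heap n = mk (heapsBelow n)

  heapsBelow : ℕ → List Game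
  heapsBelow zero = []
  heapsBelow (suc n) = heap n ∷ heapsBelow n

nim : List ℕ → Game
nim = foldr (λ n g → heap n ⊕ g) zeroG

data Reduced : Set where
  ones    : ℕ → Reduced
  onesTwo : ℕ → Reduced
  three   : Reduced
  twoTwo  : Reduced

reducedPos : Reduced → List ℕ
reducedPos (ones a) = replicate a 1
reducedPos (onesTwo a) = replicate a 1 ++ (2 ∷ [])
reducedPos three = 3 ∷ []
reducedPos twoTwo = 2 ∷ 2 ∷ []

toGame : Reduced → Game
toGame r = nim (reducedPos r)

{-# OPTIONS --safe #-}
module Submission where

open import Defs
open import Data.Bool using (true; false; T)
open import Data.Bool.ListAction using (any; all)
open import Data.Empty using (⊥-elim)
open import Data.List using (List; []; _∷_; _++_; map; null; replicate; foldr)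
open import Data.List.Membership.Propositional using (_∈_; _∉_)
open import Data.List.Membership.Propositional.Properties using (∈-++⁺ˡ; ∈-++⁺ʳ; ∈-++⁻; ∈-map⁺; ∈-map⁻)
open import Data.List.Relation.Binary.Permutation.Propositional as ↭ using (_↭_)
import Data.List.Relation.Binary.Permutation.Propositional.Properties as ↭ₚ
open import Data.List.Relation.Binary.Subset.Propositional using (_⊆_)
import Data.List.Relation.Binary.Subset.Propositional.Properties as ⊆
import Data.List.Relation.Unary.All as All
open import Data.List.Relation.Unary.All.Properties using (all⁺; all-anti-mono)
open import Data.List.Relation.Unary.Any as Any using (here; there)
open import Data.List.Relation.Unary.Any.Properties using (any⁺; any⁻)
open import Data.Nat using (ℕ; zero; suc; _+_; _%_; _⊓_; _≤_; _<_; z≤n; s≤s)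
open import Data.Nat.DivMod using ([m+n]%n≡m%n)
open import Data.Nat.Properties
  using (+-comm; ≤-refl; ≤-trans; <⇒≤; <-trans; <-cmp; n≤1+n; n<1+n; m≤m+n; m≤n⇒m≤1+n; m<n⇒m<1+n;
         m≤n⇒m<n∨m≡n; ⊓-zeroʳ)
open import Data.Product using (Σ; ∃-syntax; _×_; _,_)
open import Data.Sum using (_⊎_; inj₁; inj₂)
open import Function using (_∘_; id; flip)
open import Relation.Binary.Bundles using (Setoid)
open import Relation.Binary.Definitions using (tri<; tri≈; tri>)
open import Relation.Binary.PropositionalEquality
  using (_≡_; _≢_; refl; sym; trans; cong; cong₂; subst; module ≡-Reasoning)
import Relation.Binary.Reasoning.Setoid as SetoidReasoning
open import Relation.Binary.Structures using (IsEquivalence)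
open import Relation.Nullary using (¬_; contradiction; Dec; yes; no)

-- Sums of games are commutative and associative up to bisimilarity, so equivalence is a
-- congruence and the heaps of a position can be rearranged at will. A game with a shortcut
-- (an option A, and an option B of A that is also an option of the game) is never 𝒫, in any
-- context; every heap of size at least 2 has one. If two games are 𝒩 or 𝒬 in every context
-- and each option of either is an option of the other or never 𝒫, then they are equivalent,
-- since in every context both are 𝒩 exactly when they have a 𝒫-option; this gives n ≈ 3 for
-- n ≥ 3 and 1 + 3 ≈ 1 + 2. Two heaps of size at least 2 make a position 𝒬 in every context.
-- Adding the heaps one at a time then reduces every position to one of the listed forms.
-- To separate the forms, let probe a be the chain of 2a + 2 single-option games above the
-- heap 2: the type of 1^b + probe a is 𝒫 for b = a, 𝒩 for b = a + 1 and 𝒬 for b ≥ a + 2.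

next : GType → GType
next 𝒫 = 𝒩
next 𝒩 = 𝒪
next 𝒪 = 𝒫
next 𝒬 = 𝒬

next³ : ∀ t → next (next (next t)) ≡ t
next³ 𝒩 = refl
next³ 𝒪 = refl
next³ 𝒫 = refl
next³ 𝒬 = refl

next≡𝒩 : ∀ {t} → next t ≡ 𝒩 → t ≡ 𝒫
next≡𝒩 {𝒫} _ = refl

cyc : ℕ → GType
cyc zero = 𝒫
cyc (suc n) = next (cyc n)

cyc-mod3 : ∀ n → cyc n ≡ cyc (n % 3)
cyc-mod3 0 = refl
cyc-mod3 1 = refl
cyc-mod3 2 = refl
cyc-mod3 (suc (suc (suc n))) = begin
  next (next (next (cyc n)))  ≡⟨ next³ (cyc n) ⟩
  cyc n                       ≡⟨ cyc-mod3 n ⟩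
  cyc (n % 3)                 ≡⟨ cong cyc (sym ([m+n]%n≡m%n n 3)) ⟩
  cyc ((n + 3) % 3)           ≡⟨ cong (λ m → cyc (m % 3)) (+-comm n 3) ⟩
  cyc ((3 + n) % 3)           ∎
  where open ≡-Reasoning

withTwo : GType → GType
withTwo 𝒫 = 𝒩
withTwo 𝒩 = 𝒬
withTwo 𝒪 = 𝒩
withTwo 𝒬 = 𝒬

≡𝒬⇒≢𝒫 : ∀ {t} → t ≡ 𝒬 → t ≢ 𝒫
≡𝒬⇒≢𝒫 refl ()

≡𝒩⇒≢𝒫 : ∀ {t} → t ≡ 𝒩 → t ≢ 𝒫
≡𝒩⇒≢𝒫 refl ()

𝒫? : ∀ t → Dec (t ≡ 𝒫)
𝒫? 𝒫 = yes refl
𝒫? 𝒩 = no λ ()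
𝒫? 𝒪 = no λ ()
𝒫? 𝒬 = no λ ()

𝒩𝒬-≡ : ∀ {t u} → t ≢ 𝒫 → t ≢ 𝒪 → u ≢ 𝒫 → u ≢ 𝒪 → (t ≡ 𝒩 → u ≡ 𝒩) → (u ≡ 𝒩 → t ≡ 𝒩) → t ≡ u
𝒩𝒬-≡ {𝒫}      t≢𝒫 _   _   _   _   _   = contradiction refl t≢𝒫
𝒩𝒬-≡ {𝒪}      _   t≢𝒪 _   _   _   _   = contradiction refl t≢𝒪
𝒩𝒬-≡ {_} {𝒫}  _   _   u≢𝒫 _   _   _   = contradiction refl u≢𝒫
𝒩𝒬-≡ {_} {𝒪}  _   _   _   u≢𝒪 _   _   = contradiction refl u≢𝒪
𝒩𝒬-≡ {𝒩} {𝒩} _   _   _   _   _   _   = refl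
𝒩𝒬-≡ {𝒩} {𝒬} _   _   _   _   t⇒u _   = contradiction (t⇒u refl) λ ()
𝒩𝒬-≡ {𝒬} {𝒩} _   _   _   _   _   u⇒t = contradiction (u⇒t refl) λ ()
𝒩𝒬-≡ {𝒬} {𝒬} _   _   _   _   _   _   = refl

classify-single : ∀ t → classify (t ∷ []) ≡ next t
classify-single 𝒩 = refl
classify-single 𝒪 = refl
classify-single 𝒫 = refl
classify-single 𝒬 = refl

classify-twice : ∀ t → classify (t ∷ t ∷ []) ≡ next t
classify-twice 𝒩 = refl
classify-twice 𝒪 = refl
classify-twice 𝒫 = refl
classify-twice 𝒬 = refl

classify-withTwo : ∀ t → classify (withTwo t ∷ next (next t) ∷ next t ∷ []) ≡ withTwo (next t)
classify-withTwo 𝒩 = refl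
classify-withTwo 𝒪 = refl
classify-withTwo 𝒫 = refl
classify-withTwo 𝒬 = refl

T-isP : ∀ {t} → T (isP t) → t ≡ 𝒫
T-isP {𝒫} _ = refl

T-isN : ∀ {t} → T (isN t) → t ≡ 𝒩
T-isN {𝒩} _ = refl

T-isO : ∀ {t} → T (isO t) → t ≡ 𝒪
T-isO {𝒪} _ = refl

classify-𝒩⁺ : ∀ {ts} → 𝒫 ∈ ts → classify ts ≡ 𝒩
classify-𝒩⁺ {ts} 𝒫∈ with any isP ts | any⁺ isP (Any.map (λ { refl → _ }) 𝒫∈)
... | true | _ = refl

classify-𝒩⁻ : ∀ {ts} → classify ts ≡ 𝒩 → 𝒫 ∈ ts
classify-𝒩⁻ {ts} with any isP ts in any≡ | null ts | all isN ts | all isO ts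
... | true  | _     | _     | _     = λ _ → Any.map (λ p → sym (T-isP p)) (any⁻ isP ts (subst T (sym any≡) _))
... | false | true  | _     | true  = λ ()
... | false | true  | _     | false = λ ()
... | false | false | true  | _     = λ ()
... | false | false | false | true  = λ ()
... | false | false | false | false = λ ()

classify-𝒫⁻ : ∀ {ts t} → classify ts ≡ 𝒫 → t ∈ ts → t ≡ 𝒪
classify-𝒫⁻ {ts} with any isP ts | null ts | all isN ts | all isO ts in all≡
... | false | _     | _     | true  = λ _ t∈ → T-isO (All.lookup (all⁺ isO ts (subst T (sym all≡) _)) t∈)
... | true  | _     | _     | _     = λ ()
... | false | true  | _     | false = λ ()
... | false | false | true  | _     = λ ()
... | false | false | false | false = λ ()

classify-𝒪⁻ : ∀ {ts t} → classify ts ≡ 𝒪 → t ∈ ts → t ≡ 𝒩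
classify-𝒪⁻ {ts} with any isP ts | null ts | all isN ts in all≡ | all isO ts
... | false | false | true  | _     = λ _ t∈ → T-isN (All.lookup (all⁺ isN ts (subst T (sym all≡) _)) t∈)
... | true  | _     | _     | _     = λ ()
... | false | true  | _     | true  = λ ()
... | false | true  | _     | false = λ ()
... | false | false | false | true  = λ ()
... | false | false | false | false = λ ()

classify-𝒬⁺ : ∀ {ts} → 𝒫 ∉ ts → 𝒬 ∈ ts → classify ts ≡ 𝒬
classify-𝒬⁺ {ts} 𝒫∉ 𝒬∈ with classify ts in ts≡
... | 𝒩 = contradiction (classify-𝒩⁻ ts≡) 𝒫∉
... | 𝒪 = contradiction (classify-𝒪⁻ ts≡ 𝒬∈) λ ()
... | 𝒫 = contradiction (classify-𝒫⁻ ts≡ 𝒬∈) λ ()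
... | 𝒬 = refl

classify-𝒬-pair : ∀ {t u} → t ≢ 𝒫 → u ≢ 𝒫 → 𝒬 ∈ t ∷ u ∷ [] → classify (t ∷ u ∷ []) ≡ 𝒬
classify-𝒬-pair t≢𝒫 u≢𝒫 = classify-𝒬⁺ λ { (here 𝒫≡t) → t≢𝒫 (sym 𝒫≡t) ; (there (here 𝒫≡u)) → u≢𝒫 (sym 𝒫≡u) }

T-ext : ∀ {x y} → (T x → T y) → (T y → T x) → x ≡ y
T-ext {false} {false} _ _ = refl
T-ext {false} {true}  _ y⇒x = ⊥-elim (y⇒x _)
T-ext {true}  {false} x⇒y _ = ⊥-elim (x⇒y _)
T-ext {true}  {true}  _ _ = refl

null-cong : ∀ {ts us : List GType} → ts ⊆ us → us ⊆ ts → null ts ≡ null us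
null-cong {[]}    {[]}    _     _     = refl
null-cong {[]}    {_ ∷ _} _     us⊆ts = contradiction (us⊆ts (here refl)) λ ()
null-cong {_ ∷ _} {[]}    ts⊆us _     = contradiction (ts⊆us (here refl)) λ ()
null-cong {_ ∷ _} {_ ∷ _} _     _     = refl

classify-cong : ∀ {ts us} → ts ⊆ us → us ⊆ ts → classify ts ≡ classify us
classify-cong ts⊆us us⊆ts
  rewrite T-ext (⊆.any⁺ isP ts⊆us) (⊆.any⁺ isP us⊆ts)
        | null-cong ts⊆us us⊆ts
        | T-ext (all-anti-mono isN us⊆ts) (all-anti-mono isN ts⊆us)
        | T-ext (all-anti-mono isO us⊆ts) (all-anti-mono isO ts⊆us) = refl

opts : Game → List Game
opts (mk gs) = gs

-- Moves, equivalence, shortcuts and dead positions are records: Agda cannot infer the games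
-- from the function types they wrap, but it can from a record type.

infix 4 _⟶_

record _⟶_ (G g : Game) : Set where
  constructor move
  field ∈opts : g ∈ opts G

type∈types : ∀ {gs g} → g ∈ gs → type g ∈ types gs
type∈types (here refl) = here refl
type∈types (there g∈)  = there (type∈types g∈)

∈types⁻ : ∀ {gs t} → t ∈ types gs → ∃[ g ] g ∈ gs × type g ≡ t
∈types⁻ {g ∷ _} (here t≡) = g , here refl , sym t≡
∈types⁻ {_ ∷ _} (there t∈) = let g , g∈ , t≡ = ∈types⁻ t∈ in g , there g∈ , t≡

type≡classify : ∀ {G ts} → (∀ {g} → G ⟶ g → type g ∈ ts) →
                (∀ {t} → t ∈ ts → ∃[ g ] G ⟶ g × type g ≡ t) → type G ≡ classify ts
type≡classify {mk gs} {ts} opt⇒ ⇒opt = classify-cong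
  (λ t∈ → let g , g∈ , t≡ = ∈types⁻ t∈ in subst (_∈ ts) t≡ (opt⇒ (move g∈)))
  (λ t∈ → let g , move g∈ , t≡ = ⇒opt t∈ in subst (_∈ types gs) t≡ (type∈types g∈))

type-cong : ∀ {G H} → (∀ {g} → G ⟶ g → ∃[ h ] H ⟶ h × type g ≡ type h) →
            (∀ {h} → H ⟶ h → ∃[ g ] G ⟶ g × type g ≡ type h) → type G ≡ type H
type-cong {H = mk hs} G⇒H H⇒G = type≡classify
  (λ g⟶ → let h , move h∈ , g≡h = G⇒H g⟶ in subst (_∈ types hs) (sym g≡h) (type∈types h∈))
  (λ t∈ → let h , h∈ , t≡ = ∈types⁻ t∈ ; g , g⟶ , g≡h = H⇒G (move h∈) in g , g⟶ , trans g≡h t≡)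

type-𝒩⁺ : ∀ {G g} → G ⟶ g → type g ≡ 𝒫 → type G ≡ 𝒩
type-𝒩⁺ {mk _} (move g∈) g≡𝒫 = classify-𝒩⁺ (subst (_∈ _) g≡𝒫 (type∈types g∈))

type-𝒩⁻ : ∀ {G} → type G ≡ 𝒩 → ∃[ g ] G ⟶ g × type g ≡ 𝒫
type-𝒩⁻ {mk _} G≡𝒩 = let g , g∈ , g≡𝒫 = ∈types⁻ (classify-𝒩⁻ G≡𝒩) in g , move g∈ , g≡𝒫

type-𝒫⁻ : ∀ {G g} → type G ≡ 𝒫 → G ⟶ g → type g ≡ 𝒪
type-𝒫⁻ {mk _} G≡𝒫 (move g∈) = classify-𝒫⁻ G≡𝒫 (type∈types g∈)

type-𝒪⁻ : ∀ {G g} → type G ≡ 𝒪 → G ⟶ g → type g ≡ 𝒩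
type-𝒪⁻ {mk _} G≡𝒪 (move g∈) = classify-𝒪⁻ G≡𝒪 (type∈types g∈)

type-𝒬⁺ : ∀ {G q} → (∀ {g} → G ⟶ g → type g ≢ 𝒫) → G ⟶ q → type q ≡ 𝒬 → type G ≡ 𝒬
type-𝒬⁺ {mk _} noP (move q∈) q≡𝒬 = classify-𝒬⁺
  (λ 𝒫∈ → let g , g∈ , g≡𝒫 = ∈types⁻ 𝒫∈ in noP (move g∈) g≡𝒫)
  (subst (_∈ _) q≡𝒬 (type∈types q∈))

-- Sums

leftOpts≡map : ∀ gs H → leftOpts gs H ≡ map (_⊕ H) gs
leftOpts≡map []       H = refl
leftOpts≡map (g ∷ gs) H = cong (g ⊕ H ∷_) (leftOpts≡map gs H)

rightOpts≡map : ∀ G hs → rightOpts G hs ≡ map (G ⊕_) hs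
rightOpts≡map G []       = refl
rightOpts≡map G (h ∷ hs) = cong (G ⊕ h ∷_) (rightOpts≡map G hs)

⟶-⊕ˡ : ∀ {G g} H → G ⟶ g → G ⊕ H ⟶ g ⊕ H
⟶-⊕ˡ {mk gs} (mk hs) (move g∈) =
  move (∈-++⁺ˡ (subst (_ ∈_) (sym (leftOpts≡map gs (mk hs))) (∈-map⁺ (_⊕ mk hs) g∈)))

⟶-⊕ʳ : ∀ G {H h} → H ⟶ h → G ⊕ H ⟶ G ⊕ h
⟶-⊕ʳ (mk gs) {mk hs} (move h∈) =
  move (∈-++⁺ʳ (leftOpts gs (mk hs)) (subst (_ ∈_) (sym (rightOpts≡map (mk gs) hs)) (∈-map⁺ (mk gs ⊕_) h∈)))

data SumMove (G H : Game) : Game → Set where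
  left  : ∀ {g} → G ⟶ g → SumMove G H (g ⊕ H)
  right : ∀ {h} → H ⟶ h → SumMove G H (G ⊕ h)

sumMove : ∀ {G H o} → G ⊕ H ⟶ o → SumMove G H o
sumMove {mk gs} {mk hs} (move o∈) with ∈-++⁻ (leftOpts gs (mk hs)) o∈
... | inj₁ o∈ˡ with ∈-map⁻ (_⊕ mk hs) (subst (_ ∈_) (leftOpts≡map gs (mk hs)) o∈ˡ)
...   | _ , g∈ , refl = left (move g∈)
sumMove {mk gs} {mk hs} (move o∈) | inj₂ o∈ʳ with ∈-map⁻ (mk gs ⊕_) (subst (_ ∈_) (rightOpts≡map (mk gs) hs) o∈ʳ)
...   | _ , h∈ , refl = right (move h∈)

Game-ind : (P : Game → Set) → (∀ G → (∀ {g} → G ⟶ g → P g) → P G) → ∀ G → P G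
Game-ind P step (mk gs) = step (mk gs) λ (move g∈) → below gs g∈
  where
  below : ∀ hs {g} → g ∈ hs → P g
  below (h ∷ _)  (here refl) = Game-ind P step h
  below (_ ∷ hs) (there g∈)  = below hs g∈

infix 4 _~_

data _~_ : Game → Game → Set where
  bisim : ∀ {G H} → (∀ {g} → G ⟶ g → ∃[ h ] H ⟶ h × g ~ h) →
          (∀ {h} → H ⟶ h → ∃[ g ] G ⟶ g × g ~ h) → G ~ H

~⇒type≡ : ∀ {G H} → G ~ H → type G ≡ type H
~⇒type≡ (bisim G⇒H H⇒G) = type-cong
  (λ g⟶ → let h , h⟶ , g~h = G⇒H g⟶ in h , h⟶ , ~⇒type≡ g~h)
  (λ h⟶ → let g , g⟶ , g~h = H⇒G h⟶ in g , g⟶ , ~⇒type≡ g~h)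

~-⊕ : ∀ {G H G′ H′} →
      (∀ {o} → SumMove G H o → ∃[ o′ ] G′ ⊕ H′ ⟶ o′ × o ~ o′) →
      (∀ {o′} → SumMove G′ H′ o′ → ∃[ o ] G ⊕ H ⟶ o × o ~ o′) → G ⊕ H ~ G′ ⊕ H′
~-⊕ fwd bwd = bisim (fwd ∘ sumMove) (bwd ∘ sumMove)

⊕-comm~ : ∀ G H → G ⊕ H ~ H ⊕ G
⊕-comm~ = Game-ind _ λ G ih-G → Game-ind _ λ H ih-H → ~-⊕
  (λ { (left g⟶)  → _ , ⟶-⊕ʳ H g⟶ , ih-G g⟶ H
     ; (right h⟶) → _ , ⟶-⊕ˡ G h⟶ , ih-H h⟶ })
  (λ { (left h⟶)  → _ , ⟶-⊕ʳ G h⟶ , ih-H h⟶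
     ; (right g⟶) → _ , ⟶-⊕ˡ H g⟶ , ih-G g⟶ H })

⊕-assoc~ : ∀ A B C → (A ⊕ B) ⊕ C ~ A ⊕ (B ⊕ C)
⊕-assoc~ = Game-ind _ λ A ih-A → Game-ind _ λ B ih-B → Game-ind _ λ C ih-C →
  let fwdAB : ∀ {o} → SumMove A B o → ∃[ o′ ] A ⊕ (B ⊕ C) ⟶ o′ × o ⊕ C ~ o′
      fwdAB = λ { (left a⟶)  → _ , ⟶-⊕ˡ (B ⊕ C) a⟶ , ih-A a⟶ B C
                ; (right b⟶) → _ , ⟶-⊕ʳ A (⟶-⊕ˡ C b⟶) , ih-B b⟶ C }
      bwdBC : ∀ {o′} → SumMove B C o′ → ∃[ o ] (A ⊕ B) ⊕ C ⟶ o × o ~ A ⊕ o′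
      bwdBC = λ { (left b⟶)  → _ , ⟶-⊕ˡ C (⟶-⊕ʳ A b⟶) , ih-B b⟶ C
                ; (right c⟶) → _ , ⟶-⊕ʳ (A ⊕ B) c⟶ , ih-C c⟶ }
  in ~-⊕
  (λ { (left ab⟶) → fwdAB (sumMove ab⟶)
     ; (right c⟶) → _ , ⟶-⊕ʳ A (⟶-⊕ʳ B c⟶) , ih-C c⟶ })
  (λ { (left a⟶)   → _ , ⟶-⊕ˡ C (⟶-⊕ˡ B a⟶) , ih-A a⟶ B C
     ; (right bc⟶) → bwdBC (sumMove bc⟶) })

~-⊕ˡ : ∀ {G H} → G ~ H → ∀ X → G ⊕ X ~ H ⊕ X
~-⊕ˡ {G} {H} (bisim G⇒H H⇒G) = Game-ind _ λ X ih-X → ~-⊕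
  (λ { (left g⟶)  → let h , h⟶ , g~h = G⇒H g⟶ in _ , ⟶-⊕ˡ X h⟶ , ~-⊕ˡ g~h X
     ; (right x⟶) → _ , ⟶-⊕ʳ H x⟶ , ih-X x⟶ })
  (λ { (left h⟶)  → let g , g⟶ , g~h = H⇒G h⟶ in _ , ⟶-⊕ˡ X g⟶ , ~-⊕ˡ g~h X
     ; (right x⟶) → _ , ⟶-⊕ʳ G x⟶ , ih-X x⟶ })

⊕-identityʳ~ : ∀ G → G ⊕ zeroG ~ G
⊕-identityʳ~ = Game-ind _ λ G ih → bisim (fwd ih ∘ sumMove) λ g⟶ → _ , ⟶-⊕ˡ zeroG g⟶ , ih g⟶
  where
  fwd : ∀ {G o} → (∀ {g} → G ⟶ g → g ⊕ zeroG ~ g) → SumMove G zeroG o → ∃[ g ] G ⟶ g × o ~ g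
  fwd ih (left g⟶)        = _ , g⟶ , ih g⟶
  fwd ih (right (move ()))

infix 4 _≋_

record _≋_ (G H : Game) : Set where
  constructor ≈⇒≋
  field ≋⇒≈ : G ≈ H

open _≋_ public

≋-isEquivalence : IsEquivalence _≋_
≋-isEquivalence = record
  { refl  = ≈⇒≋ λ _ → refl
  ; sym   = λ G≋H → ≈⇒≋ λ X → sym (≋⇒≈ G≋H X)
  ; trans = λ G≋H H≋K → ≈⇒≋ λ X → trans (≋⇒≈ G≋H X) (≋⇒≈ H≋K X)
  }

≋-setoid : Setoid _ _
≋-setoid = record { isEquivalence = ≋-isEquivalence }

open IsEquivalence ≋-isEquivalence public
  using () renaming (refl to ≋-refl; sym to ≋-sym; trans to ≋-trans)

module ≋-Reasoning = SetoidReasoning ≋-setoid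

~⇒≋ : ∀ {G H} → G ~ H → G ≋ H
~⇒≋ G~H = ≈⇒≋ λ X → ~⇒type≡ (~-⊕ˡ G~H X)

⊕-comm : ∀ G H → G ⊕ H ≋ H ⊕ G
⊕-comm G H = ~⇒≋ (⊕-comm~ G H)

⊕-assoc : ∀ G H K → (G ⊕ H) ⊕ K ≋ G ⊕ (H ⊕ K)
⊕-assoc G H K = ~⇒≋ (⊕-assoc~ G H K)

⊕-identityʳ : ∀ G → G ⊕ zeroG ≋ G
⊕-identityʳ G = ~⇒≋ (⊕-identityʳ~ G)

⊕-identityˡ : ∀ G → zeroG ⊕ G ≋ G
⊕-identityˡ G = ≋-trans (⊕-comm zeroG G) (⊕-identityʳ G)

≋⇒type≡ : ∀ {G H} → G ≋ H → type G ≡ type H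
≋⇒type≡ {G} {H} G≋H = begin
  type G            ≡⟨ sym (~⇒type≡ (⊕-identityʳ~ G)) ⟩
  type (G ⊕ zeroG)  ≡⟨ ≋⇒≈ G≋H zeroG ⟩
  type (H ⊕ zeroG)  ≡⟨ ~⇒type≡ (⊕-identityʳ~ H) ⟩
  type H            ∎
  where open ≡-Reasoning

⊕-congˡ : ∀ {G H} K → G ≋ H → G ⊕ K ≋ H ⊕ K
⊕-congˡ {G} {H} K G≋H = ≈⇒≋ λ X → begin
  type ((G ⊕ K) ⊕ X)  ≡⟨ ≋⇒type≡ (⊕-assoc G K X) ⟩
  type (G ⊕ (K ⊕ X))  ≡⟨ ≋⇒≈ G≋H (K ⊕ X) ⟩
  type (H ⊕ (K ⊕ X))  ≡⟨ ≋⇒type≡ (⊕-assoc H K X) ⟨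
  type ((H ⊕ K) ⊕ X)  ∎
  where open ≡-Reasoning

⊕-congʳ : ∀ K {G H} → G ≋ H → K ⊕ G ≋ K ⊕ H
⊕-congʳ K {G} {H} G≋H = begin
  K ⊕ G  ≈⟨ ⊕-comm K G ⟩
  G ⊕ K  ≈⟨ ⊕-congˡ K G≋H ⟩
  H ⊕ K  ≈⟨ ⊕-comm H K ⟩
  K ⊕ H  ∎
  where open ≋-Reasoning

⊕-cong : ∀ {G G′ H H′} → G ≋ G′ → H ≋ H′ → G ⊕ H ≋ G′ ⊕ H′
⊕-cong {G′ = G′} {H} G≋G′ H≋H′ = ≋-trans (⊕-congˡ H G≋G′) (⊕-congʳ G′ H≋H′)

-- Games that are never 𝒫 or never 𝒪

record Shortcut (G : Game) : Set where
  constructor shortcut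
  field
    {mid end} : Game
    to-mid     : G ⟶ mid
    mid-to-end : mid ⟶ end
    to-end     : G ⟶ end

-- If G were 𝒫, then end would be 𝒪 as an option of G and 𝒩 as an option of the 𝒪-game mid.
shortcut⇒type≢𝒫 : ∀ {G} → Shortcut G → type G ≢ 𝒫
shortcut⇒type≢𝒫 (shortcut G⟶A A⟶B G⟶B) G≡𝒫 =
  contradiction (trans (sym (type-𝒪⁻ (type-𝒫⁻ G≡𝒫 G⟶A) A⟶B)) (type-𝒫⁻ G≡𝒫 G⟶B)) λ ()

shortcut-⊕ˡ : ∀ {G} → Shortcut G → ∀ X → Shortcut (G ⊕ X)
shortcut-⊕ˡ (shortcut G⟶A A⟶B G⟶B) X = shortcut (⟶-⊕ˡ X G⟶A) (⟶-⊕ˡ X A⟶B) (⟶-⊕ˡ X G⟶B)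

shortcut-⊕ʳ : ∀ G {X} → Shortcut X → Shortcut (G ⊕ X)
shortcut-⊕ʳ G (shortcut X⟶A A⟶B X⟶B) = shortcut (⟶-⊕ʳ G X⟶A) (⟶-⊕ʳ G A⟶B) (⟶-⊕ʳ G X⟶B)

NeverP NeverO : Game → Set
NeverP G = ∀ X → type (G ⊕ X) ≢ 𝒫
NeverO G = ∀ X → type (G ⊕ X) ≢ 𝒪

shortcut⇒NeverP : ∀ {G} → Shortcut G → NeverP G
shortcut⇒NeverP s X = shortcut⇒type≢𝒫 (shortcut-⊕ˡ s X)

type≢𝒪-via : ∀ {G A} → G ⟶ A → (∀ {a} → A ⟶ a → type a ≡ 𝒫 → type G ≡ 𝒩) → type G ≢ 𝒪
type≢𝒪-via G⟶A P-option⇒𝒩 G≡𝒪 =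
  let _ , A⟶a , a≡𝒫 = type-𝒩⁻ (type-𝒪⁻ G≡𝒪 G⟶A)
  in contradiction (trans (sym G≡𝒪) (P-option⇒𝒩 A⟶a a≡𝒫)) λ ()

OptionsWithin : Game → Game → Set
OptionsWithin G H = ∀ {g} → G ⟶ g → H ⟶ g ⊎ NeverP g

≋-via-options : ∀ G H → NeverP G → NeverO G → NeverP H → NeverO H →
                OptionsWithin G H → OptionsWithin H G → G ≋ H
≋-via-options G H P∉G O∉G P∉H O∉H G⊆H H⊆G = ≈⇒≋ (Game-ind _ λ X ih →
  𝒩𝒬-≡ (P∉G X) (O∉G X) (P∉H X) (O∉H X) (𝒩-transfer G⊆H ih) (𝒩-transfer H⊆G (sym ∘ ih)))
  where
  𝒩-transfer : ∀ {G H X} → OptionsWithin G H → (∀ {x} → X ⟶ x → type (G ⊕ x) ≡ type (H ⊕ x)) →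
               type (G ⊕ X) ≡ 𝒩 → type (H ⊕ X) ≡ 𝒩
  𝒩-transfer {G} {H} {X} G⊆H ih G⊕X≡𝒩 = let _ , o⟶ , o≡𝒫 = type-𝒩⁻ G⊕X≡𝒩 in via (sumMove o⟶) o≡𝒫
    where
    via : ∀ {o} → SumMove G X o → type o ≡ 𝒫 → type (H ⊕ X) ≡ 𝒩
    via (left g⟶) o≡𝒫 with G⊆H g⟶
    ... | inj₁ H⟶g  = type-𝒩⁺ (⟶-⊕ˡ X H⟶g) o≡𝒫
    ... | inj₂ P∉g  = contradiction o≡𝒫 (P∉g X)
    via (right x⟶) o≡𝒫 = type-𝒩⁺ (⟶-⊕ʳ H x⟶) (trans (sym (ih x⟶)) o≡𝒫)

heapsBelow-mono : ∀ {m n} → m ≤ n → heapsBelow m ⊆ heapsBelow n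
heapsBelow-mono {n = zero}  z≤n = λ ()
heapsBelow-mono {n = suc n} m≤1+n with m≤n⇒m<n∨m≡n m≤1+n
... | inj₁ (s≤s m≤n) = there ∘ heapsBelow-mono m≤n
... | inj₂ refl      = id

heap-mono : ∀ {m n g} → m ≤ n → heap m ⟶ g → heap n ⟶ g
heap-mono m≤n (move g∈) = move (heapsBelow-mono m≤n g∈)

heap-⟶ : ∀ {n} k → k < n → heap n ⟶ heap k
heap-⟶ _ k<n = heap-mono k<n (move (here refl))

shortcut-heap : ∀ {n} → 2 ≤ n → Shortcut (heap n)
shortcut-heap 2≤n = shortcut (heap-⟶ 1 2≤n) (heap-⟶ 0 ≤-refl) (heap-⟶ 0 (≤-trans (s≤s z≤n) 2≤n))

NeverO-heap : ∀ {n} → 3 ≤ n → NeverO (heap n)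
NeverO-heap {n} 3≤n X = type≢𝒪-via (⟶-⊕ˡ X (heap-⟶ 2 3≤n)) (λ a⟶ → via (sumMove a⟶))
  where
  via : ∀ {a} → SumMove (heap 2) X a → type a ≡ 𝒫 → type (heap n ⊕ X) ≡ 𝒩
  via (left k⟶)          a≡𝒫 = type-𝒩⁺ (⟶-⊕ˡ X (heap-mono (≤-trans (n≤1+n 2) 3≤n) k⟶)) a≡𝒫
  via (right {h = x} _) a≡𝒫 = contradiction a≡𝒫 (shortcut⇒NeverP (shortcut-heap ≤-refl) x)

heap-suc : ∀ {n} → 3 ≤ n → heap (suc n) ≋ heap n
heap-suc {n} 3≤n = ≋-via-options (heap (suc n)) (heap n)
  (shortcut⇒NeverP (shortcut-heap (m≤n⇒m≤1+n 2≤n))) (NeverO-heap (m≤n⇒m≤1+n 3≤n))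
  (shortcut⇒NeverP (shortcut-heap 2≤n)) (NeverO-heap 3≤n)
  (λ { (move (here refl))  → inj₂ (shortcut⇒NeverP (shortcut-heap 2≤n))
     ; (move (there g∈)) → inj₁ (move g∈) })
  (inj₁ ∘ heap-mono (n≤1+n n))
  where 2≤n = ≤-trans (n≤1+n 2) 3≤n

heap-≥3 : ∀ k → heap (3 + k) ≋ heap 3
heap-≥3 zero    = ≋-refl
heap-≥3 (suc k) = ≋-trans (heap-suc (m≤m+n 3 k)) (heap-≥3 k)

heap-⊓3 : ∀ n → heap n ≋ heap (n ⊓ 3)
heap-⊓3 0 = ≋-refl
heap-⊓3 1 = ≋-refl
heap-⊓3 2 = ≋-refl
heap-⊓3 (suc (suc (suc k))) rewrite ⊓-zeroʳ k = heap-≥3 k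

nim-⊓3 : ∀ p → nim p ≋ nim (map (_⊓ 3) p)
nim-⊓3 []      = ≋-refl
nim-⊓3 (n ∷ p) = ⊕-cong (heap-⊓3 n) (nim-⊓3 p)

⊕-swap : ∀ G H K → G ⊕ (H ⊕ K) ≋ H ⊕ (G ⊕ K)
⊕-swap G H K = begin
  G ⊕ (H ⊕ K)  ≈⟨ ⊕-assoc G H K ⟨
  (G ⊕ H) ⊕ K  ≈⟨ ⊕-congˡ K (⊕-comm G H) ⟩
  (H ⊕ G) ⊕ K  ≈⟨ ⊕-assoc H G K ⟩
  H ⊕ (G ⊕ K)  ∎
  where open ≋-Reasoning

nim-↭ : ∀ {p q} → p ↭ q → nim p ≋ nim q
nim-↭ ↭.refl           = ≋-refl
nim-↭ (↭.prep n p↭q)   = ⊕-congʳ (heap n) (nim-↭ p↭q)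
nim-↭ {_ ∷ _ ∷ p} (↭.swap m n p↭q) =
  ≋-trans (⊕-swap (heap m) (heap n) (nim p)) (⊕-congʳ (heap n) (⊕-congʳ (heap m) (nim-↭ p↭q)))
nim-↭ (↭.trans p↭q q↭r) = ≋-trans (nim-↭ p↭q) (nim-↭ q↭r)

stars : ℕ → Game
stars a = nim (replicate a 1)

heap⊕stars≋ : ∀ n a → heap n ⊕ stars a ≋ nim (replicate a 1 ++ n ∷ [])
heap⊕stars≋ n a = ≋-sym (nim-↭ (↭ₚ.++-comm (replicate a 1) (n ∷ [])))

shortcut-nim : ∀ p {n} → 2 ≤ n → n ∈ p → Shortcut (nim p)
shortcut-nim (_ ∷ p) 2≤n (here refl) = shortcut-⊕ˡ (shortcut-heap 2≤n) (nim p)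
shortcut-nim (m ∷ p) 2≤n (there n∈)  = shortcut-⊕ʳ (heap m) (shortcut-nim p 2≤n n∈)

-- Dead positions

record Dead (G : Game) : Set where
  constructor dead
  field type≡𝒬 : ∀ X → type (G ⊕ X) ≡ 𝒬

open Dead

Dead-resp-≋ : ∀ {G H} → G ≋ H → Dead G → Dead H
Dead-resp-≋ G≋H (dead G-𝒬) = dead λ X → trans (sym (≋⇒≈ G≋H X)) (G-𝒬 X)

Dead⇒≋ : ∀ {G H} → Dead G → Dead H → G ≋ H
Dead⇒≋ (dead G-𝒬) (dead H-𝒬) = ≈⇒≋ λ X → trans (G-𝒬 X) (sym (H-𝒬 X))

Dead-⊕ˡ : ∀ {G} → Dead G → ∀ K → Dead (G ⊕ K)
Dead-⊕ˡ {G} (dead G-𝒬) K = dead λ X → trans (~⇒type≡ (⊕-assoc~ G K X)) (G-𝒬 (K ⊕ X))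

Dead-⊕ʳ : ∀ K {G} → Dead G → Dead (K ⊕ G)
Dead-⊕ʳ K {G} G-dead = Dead-resp-≋ (⊕-comm G K) (Dead-⊕ˡ G-dead K)

Dead-intro : ∀ {K} → (∀ X {o} → K ⊕ X ⟶ o → type o ≢ 𝒫) → type K ≡ 𝒬 → Dead K
Dead-intro {K} noP K≡𝒬 = dead (Game-ind _ step)
  where
  step : ∀ X → (∀ {x} → X ⟶ x → type (K ⊕ x) ≡ 𝒬) → type (K ⊕ X) ≡ 𝒬
  step (mk [])      _  = trans (~⇒type≡ (⊕-identityʳ~ K)) K≡𝒬
  step (mk (x ∷ _)) ih = type-𝒬⁺ (noP _) (⟶-⊕ʳ K (move (here refl))) (ih (move (here refl)))

Dead-shortcuts : ∀ {G H} → Shortcut G → Shortcut H → type (G ⊕ H) ≡ 𝒬 → Dead (G ⊕ H)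
Dead-shortcuts {G} {H} sG sH = Dead-intro λ X o⟶ → shortcut⇒type≢𝒫 (shortcut-option (sumMove o⟶))
  where
  shortcut-option : ∀ {X o} → SumMove (G ⊕ H) X o → Shortcut o
  shortcut-option {X} (left gh⟶) with sumMove gh⟶
  ... | left {g} _  = shortcut-⊕ˡ (shortcut-⊕ʳ g sH) X
  ... | right {h} _ = shortcut-⊕ˡ (shortcut-⊕ˡ sG h) X
  shortcut-option (right {x} _) = shortcut-⊕ˡ (shortcut-⊕ˡ sG H) x

small-heap : ∀ {n} → 2 ≤ n → ∃[ k ] k ∈ 2 ∷ 3 ∷ [] × heap n ≋ heap k
small-heap {2}                 _           = 2 , here refl , ≋-refl
small-heap {suc (suc (suc k))} _           = 3 , there (here refl) , heap-≥3 k
small-heap {1}                 (s≤s ())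

type-small-heaps : ∀ {j k} → j ∈ 2 ∷ 3 ∷ [] → k ∈ 2 ∷ 3 ∷ [] → type (heap j ⊕ heap k) ≡ 𝒬
type-small-heaps (here refl)         (here refl)         = refl
type-small-heaps (here refl)         (there (here refl)) = refl
type-small-heaps (there (here refl)) (here refl)         = refl
type-small-heaps (there (here refl)) (there (here refl)) = refl

Dead-heaps : ∀ {m n} → 2 ≤ m → 2 ≤ n → Dead (heap m ⊕ heap n)
Dead-heaps 2≤m 2≤n =
  let _ , j∈ , m≋j = small-heap 2≤m
      _ , k∈ , n≋k = small-heap 2≤n
  in Dead-shortcuts (shortcut-heap 2≤m) (shortcut-heap 2≤n)
       (trans (≋⇒type≡ (⊕-cong m≋j n≋k)) (type-small-heaps j∈ k∈))

Dead-nim : ∀ {m n p q} → 2 ≤ m → 2 ≤ n → p ↭ m ∷ n ∷ q → Dead (nim p)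
Dead-nim {m} {n} {p} {q} 2≤m 2≤n p↭ = Dead-resp-≋ (≋-sym nim-p≋) (Dead-⊕ˡ (Dead-heaps 2≤m 2≤n) (nim q))
  where
  nim-p≋ : nim p ≋ (heap m ⊕ heap n) ⊕ nim q
  nim-p≋ = ≋-trans (nim-↭ p↭) (≋-sym (⊕-assoc (heap m) (heap n) (nim q)))

Dead-twoTwo : Dead (toGame twoTwo)
Dead-twoTwo = Dead-nim {q = []} ≤-refl ≤-refl ↭.refl

Dead-big-pair : ∀ xs b c → 2 ≤ b + c → Dead (nim (xs ++ replicate b 2 ++ replicate c 3))
Dead-big-pair xs (suc (suc b)) c             _ = Dead-nim ≤-refl ≤-refl (↭ₚ.shifts xs (2 ∷ 2 ∷ []))
Dead-big-pair xs 1             (suc c)       _ = Dead-nim ≤-refl (n≤1+n 2) (↭ₚ.shifts xs (2 ∷ 3 ∷ []))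
Dead-big-pair xs 0             (suc (suc c)) _ = Dead-nim (n≤1+n 2) (n≤1+n 2) (↭ₚ.shifts xs (3 ∷ 3 ∷ []))
Dead-big-pair xs 1             0             (s≤s ())
Dead-big-pair xs 0             1             (s≤s ())

-- Were (1 + 2) + X of type 𝒪, then its option 2 + X (if X is not 𝒫) or 1 + 1 + X (if X is 𝒫) would be 𝒩
-- without having a 𝒫-option.
NeverO-1⊕2 : NeverO (heap 1 ⊕ heap 2)
NeverO-1⊕2 X with 𝒫? (type (zeroG ⊕ X))
... | yes X≡𝒫 = type≢𝒪-via (⟶-⊕ˡ X (⟶-⊕ʳ (heap 1) (heap-⟶ 1 ≤-refl))) λ a⟶ → via (sumMove {heap 1 ⊕ heap 1} a⟶)
  where
  via : ∀ {a} → SumMove (heap 1 ⊕ heap 1) X a → type a ≡ 𝒫 → type ((heap 1 ⊕ heap 2) ⊕ X) ≡ 𝒩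
  via (left o⟶) with sumMove {heap 1} {heap 1} o⟶
  ... | left  (move (here refl)) = type-𝒩⁺ (⟶-⊕ˡ X (⟶-⊕ʳ (heap 1) (heap-⟶ {2} 0 (s≤s z≤n))))
                                   ∘ trans (sym (≋⇒≈ (⊕-comm (heap 0) (heap 1)) X))
  ... | right (move (here refl)) = type-𝒩⁺ (⟶-⊕ˡ X (⟶-⊕ʳ (heap 1) (heap-⟶ {2} 0 (s≤s z≤n))))
  via (right {x} x⟶) x≡𝒫 =
    let 1⊕x≡𝒪 = type-𝒫⁻ x≡𝒫 (⟶-⊕ˡ x (⟶-⊕ʳ (heap 1) (heap-⟶ 0 ≤-refl)))
    in contradiction (trans (sym (type-𝒪⁻ 1⊕x≡𝒪 (⟶-⊕ˡ x (⟶-⊕ˡ (heap 0) (heap-⟶ 0 ≤-refl)))))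
                            (type-𝒫⁻ X≡𝒫 (⟶-⊕ʳ zeroG x⟶))) λ ()
... | no X≢𝒫 = type≢𝒪-via (⟶-⊕ˡ X (⟶-⊕ˡ (heap 2) (heap-⟶ 0 ≤-refl))) λ a⟶ → via (sumMove {heap 0 ⊕ heap 2} a⟶)
  where
  via : ∀ {a} → SumMove (heap 0 ⊕ heap 2) X a → type a ≡ 𝒫 → type ((heap 1 ⊕ heap 2) ⊕ X) ≡ 𝒩
  via (left o⟶) with sumMove {heap 0} {heap 2} o⟶
  ... | left  (move ())
  ... | right (move (here refl))         = type-𝒩⁺ (⟶-⊕ˡ X (⟶-⊕ʳ (heap 1) (heap-⟶ {2} 0 (s≤s z≤n))))
                                           ∘ trans (sym (≋⇒≈ (⊕-comm (heap 0) (heap 1)) X))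
  ... | right (move (there (here refl))) = flip contradiction X≢𝒫
  via (right {x} _) = flip contradiction (shortcut⇒NeverP (shortcut-⊕ʳ (heap 0) (shortcut-heap ≤-refl)) x)

NeverO-1⊕3 : NeverO (heap 1 ⊕ heap 3)
NeverO-1⊕3 X = type≢𝒪-via (⟶-⊕ˡ X (⟶-⊕ʳ (heap 1) (heap-⟶ 2 ≤-refl))) λ a⟶ → via (sumMove {heap 1 ⊕ heap 2} a⟶)
  where
  via : ∀ {a} → SumMove (heap 1 ⊕ heap 2) X a → type a ≡ 𝒫 → type ((heap 1 ⊕ heap 3) ⊕ X) ≡ 𝒩
  via (left o⟶) with sumMove {heap 1} {heap 2} o⟶
  ... | left {g} _ = flip contradiction (shortcut⇒NeverP (shortcut-⊕ʳ g (shortcut-heap ≤-refl)) X)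
  ... | right h⟶   = type-𝒩⁺ (⟶-⊕ˡ X (⟶-⊕ʳ (heap 1) (heap-mono (n≤1+n 2) h⟶)))
  via (right {x} _) = flip contradiction (shortcut⇒NeverP (shortcut-⊕ʳ (heap 1) (shortcut-heap ≤-refl)) x)

1⊕3≋1⊕2 : heap 1 ⊕ heap 3 ≋ heap 1 ⊕ heap 2
1⊕3≋1⊕2 = ≋-via-options (heap 1 ⊕ heap 3) (heap 1 ⊕ heap 2)
  (shortcut⇒NeverP (shortcut-⊕ʳ (heap 1) (shortcut-heap (n≤1+n 2)))) NeverO-1⊕3
  (shortcut⇒NeverP (shortcut-⊕ʳ (heap 1) (shortcut-heap ≤-refl))) NeverO-1⊕2
  3-within-2 2-within-3
  where
  3-within-2 : OptionsWithin (heap 1 ⊕ heap 3) (heap 1 ⊕ heap 2)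
  3-within-2 o⟶ with sumMove {heap 1} {heap 3} o⟶
  ... | left {g} _               = inj₂ (shortcut⇒NeverP (shortcut-⊕ʳ g (shortcut-heap (n≤1+n 2))))
  ... | right (move (here refl)) = inj₂ (shortcut⇒NeverP (shortcut-⊕ʳ (heap 1) (shortcut-heap ≤-refl)))
  ... | right (move (there h∈))  = inj₁ (⟶-⊕ʳ (heap 1) (move h∈))
  2-within-3 : OptionsWithin (heap 1 ⊕ heap 2) (heap 1 ⊕ heap 3)
  2-within-3 o⟶ with sumMove {heap 1} {heap 2} o⟶
  ... | left {g} _ = inj₂ (shortcut⇒NeverP (shortcut-⊕ʳ g (shortcut-heap ≤-refl)))
  ... | right h⟶   = inj₁ (⟶-⊕ʳ (heap 1) (heap-mono (n≤1+n 2) h⟶))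

ones-three≋ones-two : ∀ a → nim (replicate (suc a) 1 ++ 3 ∷ []) ≋ nim (replicate (suc a) 1 ++ 2 ∷ [])
ones-three≋ones-two zero = begin
  heap 1 ⊕ (heap 3 ⊕ zeroG)  ≈⟨ ⊕-congʳ (heap 1) (⊕-identityʳ (heap 3)) ⟩
  heap 1 ⊕ heap 3            ≈⟨ 1⊕3≋1⊕2 ⟩
  heap 1 ⊕ heap 2            ≈⟨ ⊕-congʳ (heap 1) (⊕-identityʳ (heap 2)) ⟨
  heap 1 ⊕ (heap 2 ⊕ zeroG)  ∎
  where open ≋-Reasoning
ones-three≋ones-two (suc a) = ⊕-congʳ (heap 1) (ones-three≋ones-two a)

-- Sums of ones

τ : ℕ → Game → GType
τ b X = type (stars b ⊕ X)

stars-option : ∀ b {o} → stars (suc b) ⟶ o → o ≋ stars b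
stars-option b o⟶ with sumMove {heap 1} {stars b} o⟶
... | left (move (here refl)) = ⊕-identityˡ (stars b)
stars-option (suc b) _ | right s⟶ = ⊕-congʳ (heap 1) (stars-option b s⟶)

τ-suc : ∀ b X → τ (suc b) X ≡ classify (τ b X ∷ map (τ (suc b)) (opts X))
τ-suc b X = type≡classify option-type move-to
  where
  option-type : ∀ {o} → stars (suc b) ⊕ X ⟶ o → type o ∈ τ b X ∷ map (τ (suc b)) (opts X)
  option-type o⟶ with sumMove {stars (suc b)} o⟶
  ... | left s⟶           = here (≋⇒≈ (stars-option b s⟶) X)
  ... | right (move x∈)   = there (∈-map⁺ (τ (suc b)) x∈)
  move-to : ∀ {t} → t ∈ τ b X ∷ map (τ (suc b)) (opts X) → ∃[ o ] stars (suc b) ⊕ X ⟶ o × type o ≡ t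
  move-to (here refl) = _ , ⟶-⊕ˡ X (⟶-⊕ˡ (stars b) (heap-⟶ 0 ≤-refl)) , ≋⇒≈ (⊕-identityˡ (stars b)) X
  move-to (there t∈)  = let x , x∈ , t≡ = ∈-map⁻ (τ (suc b)) t∈ in _ , ⟶-⊕ʳ (stars (suc b)) (move x∈) , sym t≡

τ-zeroG : ∀ a → τ a zeroG ≡ cyc a
τ-zeroG zero    = refl
τ-zeroG (suc a) = trans (τ-suc a zeroG) (trans (classify-single (τ a zeroG)) (cong next (τ-zeroG a)))

type-stars : ∀ a → type (stars a) ≡ cyc a
type-stars a = trans (sym (~⇒type≡ (⊕-identityʳ~ (stars a)))) (τ-zeroG a)

τ-heap1 : ∀ b → τ b (heap 1) ≡ cyc (suc b)
τ-heap1 b = trans (~⇒type≡ (⊕-comm~ (stars b) (heap 1))) (type-stars (suc b))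

τ-heap2 : ∀ a → τ a (heap 2) ≡ withTwo (cyc a)
τ-heap2 zero    = refl
τ-heap2 (suc a) rewrite τ-suc a (heap 2) | τ-heap2 a | τ-heap1 (suc a) | τ-zeroG (suc a) =
  classify-withTwo (cyc a)

onesTwo≋ : ∀ a → toGame (onesTwo a) ≋ stars a ⊕ heap 2
onesTwo≋ a = ≋-trans (≋-sym (heap⊕stars≋ 2 a)) (⊕-comm (heap 2) (stars a))

type-onesTwo : ∀ a → type (toGame (onesTwo a)) ≡ withTwo (cyc (a % 3))
type-onesTwo a = trans (≋⇒type≡ (onesTwo≋ a)) (trans (τ-heap2 a) (cong withTwo (cyc-mod3 a)))

-- Probes

single : Game → Game
single X = mk (X ∷ [])

record Profile (X : Game) (m : ℕ) (t : GType) : Set where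
  field
    regular : ∀ {b} → b < m → τ (suc b) X ≡ next (τ b X)
    edge    : τ m X ≡ t
    beyond  : ∀ {b} → m < b → τ b X ≡ 𝒬

open Profile

single-below : ∀ {X m} → (∀ {b} → b < m → τ (suc b) X ≡ next (τ b X)) →
               ∀ {b} → b ≤ m → τ b (single X) ≡ next (τ b X)
single-below {X} _   {zero}  _     = classify-single (τ 0 X)
single-below {X} reg {suc b} 1+b≤m = begin
  τ (suc b) (single X)                                  ≡⟨ τ-suc b (single X) ⟩
  classify (τ b (single X) ∷ τ (suc b) X ∷ [])
    ≡⟨ cong₂ (λ t u → classify (t ∷ u ∷ [])) (single-below reg (<⇒≤ 1+b≤m)) (reg 1+b≤m) ⟩
  classify (next (τ b X) ∷ next (τ b X) ∷ [])           ≡⟨ classify-twice (next (τ b X)) ⟩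
  next (next (τ b X))                                   ≡⟨ cong next (reg 1+b≤m) ⟨
  next (τ (suc b) X)                                    ∎
  where open ≡-Reasoning

single-regular : ∀ {X m} → (∀ {b} → b < m → τ (suc b) X ≡ next (τ b X)) →
                 ∀ {b} → b < m → τ (suc b) (single X) ≡ next (τ b (single X))
single-regular {X} reg {b} b<m = begin
  τ (suc b) (single X)   ≡⟨ single-below reg b<m ⟩
  next (τ (suc b) X)     ≡⟨ cong next (reg b<m) ⟩
  next (next (τ b X))    ≡⟨ cong next (single-below reg (<⇒≤ b<m)) ⟨
  next (τ b (single X))  ∎
  where open ≡-Reasoning

single-beyond : ∀ {X m} → (∀ {b} → m < b → τ b X ≢ 𝒫) → τ (suc m) X ≡ 𝒬 → τ m (single X) ≢ 𝒫 →
                ∀ {b} → m < b → τ b (single X) ≡ 𝒬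
single-beyond {X} {m} noP Q≡ m≢𝒫 {suc b} (s≤s m≤b) with m≤n⇒m<n∨m≡n m≤b
... | inj₂ refl = trans (τ-suc m (single X))
                        (classify-𝒬-pair m≢𝒫 (noP ≤-refl) (there (here (sym Q≡))))
... | inj₁ m<b  = let b≡𝒬 = single-beyond noP Q≡ m≢𝒫 m<b in
  trans (τ-suc b (single X)) (classify-𝒬-pair (≡𝒬⇒≢𝒫 b≡𝒬) (noP (s≤s m≤b)) (here (sym b≡𝒬)))

profile-single : ∀ {X m t} → Profile X m t → next t ≢ 𝒫 → Profile (single X) m (next t)
profile-single {X} {m} {t} p next-t≢𝒫 = record
  { regular = single-regular (regular p)
  ; edge    = edge-single
  ; beyond  = single-beyond (≡𝒬⇒≢𝒫 ∘ beyond p) (beyond p ≤-refl) (next-t≢𝒫 ∘ trans (sym edge-single))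
  }
  where
  edge-single : τ m (single X) ≡ next t
  edge-single = trans (single-below (regular p) ≤-refl) (cong next (edge p))

profile-single-𝒪 : ∀ {X m} → Profile X m 𝒪 → Profile (single X) (suc m) 𝒩
profile-single-𝒪 {X} {m} p = record
  { regular = regular-single
  ; edge    = edge-single
  ; beyond  = single-beyond (≡𝒬⇒≢𝒫 ∘ beyond p ∘ <-trans (n<1+n m)) (beyond p (m<n⇒m<1+n (n<1+n m)))
                            (≡𝒩⇒≢𝒫 edge-single)
  }
  where
  m≡𝒫 : τ m (single X) ≡ 𝒫
  m≡𝒫 = trans (single-below (regular p) ≤-refl) (cong next (edge p))
  edge-single : τ (suc m) (single X) ≡ 𝒩
  edge-single = trans (τ-suc m (single X)) (cong (λ t → classify (t ∷ τ (suc m) X ∷ [])) m≡𝒫)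
  regular-single : ∀ {b} → b < suc m → τ (suc b) (single X) ≡ next (τ b (single X))
  regular-single (s≤s b≤m) with m≤n⇒m<n∨m≡n b≤m
  ... | inj₁ b<m  = single-regular (regular p) b<m
  ... | inj₂ refl = trans edge-single (cong next (sym m≡𝒫))

probe : ℕ → Game
probe zero    = single (single (heap 2))
probe (suc a) = single (single (probe a))

profile-single-heap2 : Profile (single (heap 2)) 0 𝒪
profile-single-heap2 = record
  { regular = λ ()
  ; edge    = refl
  ; beyond  = single-beyond (λ {b} _ → shortcut⇒type≢𝒫 (shortcut-⊕ʳ (stars b) (shortcut-heap ≤-refl)))
                            refl λ ()
  }

profile-probe : ∀ a → Profile (probe a) (suc a) 𝒩
profile-probe zero    = profile-single-𝒪 profile-single-heap2
profile-probe (suc a) = profile-single-𝒪 (profile-single (profile-probe a) λ ())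

τ-probe-𝒫 : ∀ a → τ a (probe a) ≡ 𝒫
τ-probe-𝒫 a = next≡𝒩 (trans (sym (regular (profile-probe a) ≤-refl)) (edge (profile-probe a)))

τ-probe-𝒬 : ∀ {a b} → suc a < b → τ b (probe a) ≡ 𝒬
τ-probe-𝒬 {a} = beyond (profile-probe a)

τ-probe-≢𝒫 : ∀ {a b} → a < b → τ b (probe a) ≢ 𝒫
τ-probe-≢𝒫 {a} (s≤s a≤b) with m≤n⇒m<n∨m≡n a≤b
... | inj₁ a<b  = ≡𝒬⇒≢𝒫 (τ-probe-𝒬 (s≤s a<b))
... | inj₂ refl = ≡𝒩⇒≢𝒫 (edge (profile-probe a))

-- Reduced forms

addHeap : ℕ → Reduced → Reduced
addHeap 0                   r              = r
addHeap 1                   (ones a)       = ones (suc a)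
addHeap 1                   (onesTwo a)    = onesTwo (suc a)
addHeap 1                   three          = onesTwo 1
addHeap 1                   twoTwo         = twoTwo
addHeap (suc (suc _))       (onesTwo _)    = twoTwo
addHeap (suc (suc _))       three          = twoTwo
addHeap (suc (suc _))       twoTwo         = twoTwo
addHeap 2                   (ones a)       = onesTwo a
addHeap (suc (suc (suc _))) (ones zero)    = three
addHeap (suc (suc (suc _))) (ones (suc a)) = onesTwo (suc a)

addHeap-correct : ∀ n r → heap n ⊕ toGame r ≋ toGame (addHeap n r)
addHeap-correct 0 r                   = ⊕-identityˡ (toGame r)
addHeap-correct 1 (ones a)            = ≋-refl
addHeap-correct 1 (onesTwo a)         = ≋-refl
addHeap-correct 1 three               = ones-three≋ones-two 0
addHeap-correct 1 twoTwo              = Dead⇒≋ (Dead-⊕ʳ (heap 1) Dead-twoTwo) Dead-twoTwo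
addHeap-correct 2 (ones a)            = heap⊕stars≋ 2 a
addHeap-correct (suc (suc (suc k))) (ones zero)    = ⊕-congˡ zeroG (heap-≥3 k)
addHeap-correct (suc (suc (suc k))) (ones (suc a)) = begin
  heap (3 + k) ⊕ stars (suc a)            ≈⟨ ⊕-congˡ (stars (suc a)) (heap-≥3 k) ⟩
  heap 3 ⊕ stars (suc a)                  ≈⟨ heap⊕stars≋ 3 (suc a) ⟩
  nim (replicate (suc a) 1 ++ 3 ∷ [])     ≈⟨ ones-three≋ones-two a ⟩
  nim (replicate (suc a) 1 ++ 2 ∷ [])     ∎
  where open ≋-Reasoning
addHeap-correct (suc (suc k)) (onesTwo a) =
  Dead⇒≋ (Dead-nim 2≤2+k ≤-refl (↭.prep (2 + k) (↭ₚ.++-comm (replicate a 1) (2 ∷ [])))) Dead-twoTwo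
  where 2≤2+k = m≤m+n 2 k
addHeap-correct (suc (suc k)) three  = Dead⇒≋ (Dead-nim {q = []} (m≤m+n 2 k) (n≤1+n 2) ↭.refl) Dead-twoTwo
addHeap-correct (suc (suc k)) twoTwo = Dead⇒≋ (Dead-⊕ʳ (heap (2 + k)) Dead-twoTwo) Dead-twoTwo

reduce : List ℕ → Reduced
reduce = foldr addHeap (ones 0)

reduce-correct : ∀ p → nim p ≋ toGame (reduce p)
reduce-correct []      = ≋-refl
reduce-correct (n ∷ p) = ≋-trans (⊕-congʳ (heap n) (reduce-correct p)) (addHeap-correct n (reduce p))

shortcut-onesTwo : ∀ a → Shortcut (toGame (onesTwo a))
shortcut-onesTwo a = shortcut-nim (replicate a 1 ++ 2 ∷ []) ≤-refl (∈-++⁺ʳ (replicate a 1) (here refl))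

shortcut-three : Shortcut (toGame three)
shortcut-three = shortcut-nim (3 ∷ []) (n≤1+n 2) (here refl)

shortcut-twoTwo : Shortcut (toGame twoTwo)
shortcut-twoTwo = shortcut-nim (2 ∷ 2 ∷ []) ≤-refl (here refl)

distinguished-by : ∀ {G H} X → type (G ⊕ X) ≢ type (H ⊕ X) → ¬ G ≋ H
distinguished-by X types≢ G≋H = types≢ (≋⇒≈ G≋H X)

<-separated⇒injective : ∀ (f : ℕ → Game) → (∀ {a b} → a < b → ¬ f a ≋ f b) → ∀ a b → f a ≋ f b → a ≡ b
<-separated⇒injective f separated a b fa≋fb with <-cmp a b
... | tri< a<b _ _ = contradiction fa≋fb (separated a<b)
... | tri≈ _ a≡b _ = a≡b
... | tri> _ _ b<a = contradiction (≋-sym fa≋fb) (separated b<a)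

stars-separated : ∀ {a b} → a < b → ¬ stars a ≋ stars b
stars-separated {a} a<b = distinguished-by (probe a) λ types≡ →
  τ-probe-≢𝒫 a<b (trans (sym types≡) (τ-probe-𝒫 a))

stars≉shortcut : ∀ a {G} → Shortcut G → ¬ stars a ≋ G
stars≉shortcut a sG = distinguished-by (probe a) λ types≡ →
  shortcut⇒NeverP sG (probe a) (trans (sym types≡) (τ-probe-𝒫 a))

type-onesTwo-probe-𝒩 : ∀ a → type (toGame (onesTwo a) ⊕ probe a) ≡ 𝒩
type-onesTwo-probe-𝒩 a = trans (≋⇒≈ (onesTwo≋ a) (probe a))
  (type-𝒩⁺ (⟶-⊕ˡ (probe a) (⟶-⊕ʳ (stars a) (heap-⟶ {2} 0 (s≤s z≤n))))
           (trans (≋⇒≈ (⊕-identityʳ (stars a)) (probe a)) (τ-probe-𝒫 a)))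

type-onesTwo-probe-𝒬 : ∀ {a b} → a < b → type (toGame (onesTwo b) ⊕ probe a) ≡ 𝒬
type-onesTwo-probe-𝒬 {a} {b} a<b = trans (≋⇒≈ (onesTwo≋ b) (probe a))
  (type-𝒬⁺ (λ o⟶ → no-𝒫 (sumMove {stars b ⊕ heap 2} o⟶))
           (⟶-⊕ˡ (probe a) (⟶-⊕ʳ (stars b) (heap-⟶ 1 ≤-refl))) stars⊕1≡𝒬)
  where
  stars⊕1≡𝒬 : type ((stars b ⊕ heap 1) ⊕ probe a) ≡ 𝒬
  stars⊕1≡𝒬 = trans (≋⇒≈ (⊕-comm (stars b) (heap 1)) (probe a)) (τ-probe-𝒬 (s≤s a<b))
  no-𝒫 : ∀ {o} → SumMove (stars b ⊕ heap 2) (probe a) o → type o ≢ 𝒫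
  no-𝒫 (left o⟶) with sumMove {stars b} {heap 2} o⟶
  ... | left {s} _                       = shortcut⇒NeverP (shortcut-⊕ʳ s (shortcut-heap ≤-refl)) (probe a)
  ... | right (move (here refl))         = ≡𝒬⇒≢𝒫 stars⊕1≡𝒬
  ... | right (move (there (here refl))) = τ-probe-≢𝒫 a<b ∘ trans (sym (≋⇒≈ (⊕-identityʳ (stars b)) (probe a)))
  no-𝒫 (right {f} _) = shortcut⇒NeverP (shortcut-⊕ʳ (stars b) (shortcut-heap ≤-refl)) f

onesTwo-separated : ∀ {a b} → a < b → ¬ toGame (onesTwo a) ≋ toGame (onesTwo b)
onesTwo-separated {a} a<b = distinguished-by (probe a) λ types≡ →
  contradiction (trans (sym (type-onesTwo-probe-𝒩 a)) (trans types≡ (type-onesTwo-probe-𝒬 a<b))) λ ()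

onesTwo≉twoTwo : ∀ a → ¬ toGame (onesTwo a) ≋ toGame twoTwo
onesTwo≉twoTwo a = distinguished-by (probe a) λ types≡ →
  contradiction (trans (sym (type-onesTwo-probe-𝒩 a)) (trans types≡ (type≡𝒬 Dead-twoTwo (probe a)))) λ ()

-- 2 + {0, 1 + 1} is 𝒪 but 3 + {0, 1 + 1} is 𝒬.
onesTwo≉three : ∀ a → ¬ toGame (onesTwo a) ≋ toGame three
onesTwo≉three zero    = distinguished-by (mk (zeroG ∷ stars 2 ∷ [])) λ ()
onesTwo≉three (suc a) = distinguished-by (probe 0) λ types≡ →
  contradiction (trans (sym (type-onesTwo-probe-𝒬 {b = suc a} (s≤s z≤n))) types≡) λ ()

three≉twoTwo : ¬ toGame three ≋ toGame twoTwo
three≉twoTwo = distinguished-by zeroG λ ()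

toGame-injective : ∀ r s → toGame r ≋ toGame s → r ≡ s
toGame-injective (ones a)    (ones b)    e = cong ones (<-separated⇒injective stars stars-separated a b e)
toGame-injective (onesTwo a) (onesTwo b) e =
  cong onesTwo (<-separated⇒injective (toGame ∘ onesTwo) onesTwo-separated a b e)
toGame-injective three       three       _ = refl
toGame-injective twoTwo      twoTwo      _ = refl
toGame-injective (ones a)    (onesTwo b) e = contradiction e (stars≉shortcut a (shortcut-onesTwo b))
toGame-injective (ones a)    three       e = contradiction e (stars≉shortcut a shortcut-three)
toGame-injective (ones a)    twoTwo      e = contradiction e (stars≉shortcut a shortcut-twoTwo)
toGame-injective (onesTwo a) (ones b)    e = contradiction (≋-sym e) (stars≉shortcut b (shortcut-onesTwo a))
toGame-injective three       (ones b)    e = contradiction (≋-sym e) (stars≉shortcut b shortcut-three)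
toGame-injective twoTwo      (ones b)    e = contradiction (≋-sym e) (stars≉shortcut b shortcut-twoTwo)
toGame-injective (onesTwo a) three       e = contradiction e (onesTwo≉three a)
toGame-injective three       (onesTwo a) e = contradiction (≋-sym e) (onesTwo≉three a)
toGame-injective (onesTwo a) twoTwo      e = contradiction e (onesTwo≉twoTwo a)
toGame-injective twoTwo      (onesTwo a) e = contradiction (≋-sym e) (onesTwo≉twoTwo a)
toGame-injective three       twoTwo      e = contradiction e three≉twoTwo
toGame-injective twoTwo      three       e = contradiction (≋-sym e) three≉twoTwo

by-residue : ∀ (f : ℕ → GType) a {t} → t ≡ f (a % 3) →
             (a % 3 ≡ 0 → t ≡ f 0) × (a % 3 ≡ 1 → t ≡ f 1) × (a % 3 ≡ 2 → t ≡ f 2)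
by-residue f a {t} t≡ = at , at , at
  where
  at : ∀ {r} → a % 3 ≡ r → t ≡ f r
  at a%3≡r = trans t≡ (cong f a%3≡r)

mainTheorem13 :
  -- every Nim position is equivalent to some reduced form
  ((p : List ℕ) → Σ Reduced (λ r → nim p ≈ toGame r))
  -- ... and to only one
  × ((p : List ℕ) (r s : Reduced) → nim p ≈ toGame r → nim p ≈ toGame s → r ≡ s)
  -- the reduced forms are pairwise inequivalent
  × ((r s : Reduced) → ¬ r ≡ s → ¬ (toGame r ≈ toGame s))
  -- types of 1^a
  × ((a : ℕ) → (a % 3 ≡ 0 → type (toGame (ones a)) ≡ 𝒫)
              × (a % 3 ≡ 1 → type (toGame (ones a)) ≡ 𝒩)
              × (a % 3 ≡ 2 → type (toGame (ones a)) ≡ 𝒪))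
  -- types of 1^a + 2
  × ((a : ℕ) → (a % 3 ≡ 0 → type (toGame (onesTwo a)) ≡ 𝒩)
              × (a % 3 ≡ 1 → type (toGame (onesTwo a)) ≡ 𝒬)
              × (a % 3 ≡ 2 → type (toGame (onesTwo a)) ≡ 𝒩))
  -- types of 3 and 2 + 2
  × type (toGame three) ≡ 𝒩
  × type (toGame twoTwo) ≡ 𝒬
  -- replacing every heap of size > 3 by a heap of size 3 gives an equivalent position
  × ((p : List ℕ) → nim p ≈ nim (map (λ n → n ⊓ 3) p))
  -- 1^a + 2^b + 3^c with b + c ≥ 2 is equivalent to 2 + 2
  × ((a b c : ℕ) → 2 ≤ b + c →
       nim (replicate a 1 ++ replicate b 2 ++ replicate c 3) ≈ toGame twoTwo)
  -- 1^a + 3 is equivalent to 1^a + 2 when a ≥ 1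
  × ((a : ℕ) → 1 ≤ a → nim (replicate a 1 ++ (3 ∷ [])) ≈ toGame (onesTwo a))
mainTheorem13 =
    (λ p → reduce p , ≋⇒≈ (reduce-correct p))
  , (λ p r s p≈r p≈s → toGame-injective r s (≋-trans (≋-sym (≈⇒≋ {nim p} p≈r)) (≈⇒≋ p≈s)))
  , (λ r s r≢s r≈s → r≢s (toGame-injective r s (≈⇒≋ r≈s)))
  , (λ a → by-residue cyc a (trans (type-stars a) (cyc-mod3 a)))
  , (λ a → by-residue (withTwo ∘ cyc) a (type-onesTwo a))
  , refl
  , refl
  , (λ p → ≋⇒≈ (nim-⊓3 p))
  , (λ a b c 2≤b+c → ≋⇒≈ (Dead⇒≋ (Dead-big-pair (replicate a 1) b c 2≤b+c) Dead-twoTwo))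
  , λ { zero () ; (suc a) _ → ≋⇒≈ (ones-three≋ones-two a) }
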